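{- Let $g \geq 2$ be an integer. Let $n$ and $n_1, \dots, n_v$ be positive integers such that $[n]_g = [n_1]_g \mid \cdots \mid [n_v]_g$ and, for each $i = 1, \dots, v$, $n_i$ is the sum of $t_i$ base-$g$ Niven numbers. Then $n$ is the sum of $t_1 + \cdots + t_v$ base-$g$ Niven numbers.
   Context: For a positive integer $n$, write uniquely $n = \sum_{i=1}^{\ell} d_i g^{i-1}$ with $d_1,\dots,d_\ell \in \{0,\dots,g-1\}$ and $d_\ell \neq 0$; $[n]_g$ denotes the string $d_1, \dots, d_\ell$ (least significant digit first). For strings $a, b$, $a \mid b$ denotes their concatenation. A natural number is a base-$g$ Niven number if it is divisible by the sum of its base-$g$ digits. -}

module Defs where

open import Data.Nat using (ℕ; zero; suc; _+_; _<_; _≤_; NonZero)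
open import Data.Nat.DivMod using (_/_; _%_)
open import Data.Nat.Divisibility using (_∣_)
open import Data.List using (List; []; _∷_; length)
open import Data.Nat.ListAction using (sum)
open import Relation.Binary.PropositionalEquality using (_≡_)
open import Data.List.Relation.Unary.All using (All)
open import Data.Product using (Σ; _×_)

-- Base-g digits of n, least significant first, no leading (i.e. trailing) zeros.
-- [0]_g is the empty list. Fuel: n itself suffices since n / g < n for n ≥ 1, g ≥ 2.
digitsAux : (g : ℕ) → .{{NonZero g}} → (fuel n : ℕ) → List ℕ
digitsAux g zero    n       = []
digitsAux g (suc f) zero    = []
digitsAux g (suc f) (suc m) = (suc m % g) ∷ digitsAux g f (suc m / g)

digits : (g : ℕ) → .{{NonZero g}} → ℕ → List ℕ
digits g n = digitsAux g n n

digitSum : (g : ℕ) → .{{NonZero g}} → ℕ → ℕ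
digitSum g n = sum (digits g n)

IsNiven : (g : ℕ) → .{{NonZero g}} → ℕ → Set
IsNiven g n = 0 < n × digitSum g n ∣ n

SumOfNiven : (g : ℕ) → .{{NonZero g}} → (t n : ℕ) → Set
SumOfNiven g t n = Σ (List ℕ) λ xs → length xs ≡ t × All (IsNiven g) xs × sum xs ≡ n

module Submission where

open import Defs
open import Data.Nat using (ℕ; _≤_; _<_; NonZero)
open import Data.Vec using (Vec; toList; map; sum; lookup)
open import Data.List using (List; concat)
open import Relation.Binary.PropositionalEquality using (_≡_)

open import Data.Nat using (zero; suc; _+_; _*_; _^_; pred; z≤n; s≤s; >-nonZero)
open import Data.Nat.Properties
open import Data.Nat.DivMod using (_/_; _%_; m≡m%n+[m/n]*n; m*n%n≡0; m*n/n≡m; m/n<m)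
open import Data.Nat.Divisibility using (_∣_; ∣m⇒∣m*n)
import Data.List as List
open import Data.List using ([]; _∷_; _++_; length)
open import Data.List.Properties using (length-map; length-++)
open import Data.Nat.ListAction using () renaming (sum to sumList)
open import Data.Nat.ListAction.Properties using (sum-++)
open import Data.List.Relation.Unary.All using ([])
import Data.List.Relation.Unary.All as All
open import Data.List.Relation.Unary.All.Properties using (++⁺; map⁺)
open import Data.Vec using (_∷_; [])
open import Data.Fin using (zero; suc)
open import Data.Product using (_,_)
open import Relation.Binary.PropositionalEquality
  using (refl; sym; trans; cong; cong₂; subst; module ≡-Reasoning)

-- Concatenating digit strings means n = n₁ + n₂ g^ℓ₁ + n₃ g^(ℓ₁+ℓ₂) + ⋯, where
-- ℓᵢ is the length of [nᵢ]_g. A new lowest digit 0 multiplies by g without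
-- changing the digit sum, so g times a Niven number is Niven; hence nᵢ g^k is a
-- sum of tᵢ Niven numbers, and adding up these representations gives n.

sum-map-*ʳ : ∀ c xs → sumList (List.map (_* c) xs) ≡ sumList xs * c
sum-map-*ʳ c [] = refl
sum-map-*ʳ c (x ∷ xs) =
  trans (cong (x * c +_) (sum-map-*ʳ c xs)) (sym (*-distribʳ-+ c x (sumList xs)))

module _ (g : ℕ) .{{_ : NonZero g}} (2≤g : 2 ≤ g) where

  fromDigits : List ℕ → ℕ
  fromDigits []       = 0
  fromDigits (d ∷ ds) = d + fromDigits ds * g

  fromDigits-++ : ∀ xs ys → fromDigits (xs ++ ys) ≡ fromDigits xs + fromDigits ys * g ^ length xs
  fromDigits-++ [] ys = sym (*-identityʳ (fromDigits ys))
  fromDigits-++ (x ∷ xs) ys = begin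
      x + fromDigits (xs ++ ys) * g
    ≡⟨ cong (λ z → x + z * g) (fromDigits-++ xs ys) ⟩
      x + (fromDigits xs + fromDigits ys * g ^ length xs) * g
    ≡⟨ cong (x +_) (*-distribʳ-+ g (fromDigits xs) _) ⟩
      x + (fromDigits xs * g + fromDigits ys * g ^ length xs * g)
    ≡⟨ sym (+-assoc x _ _) ⟩
      x + fromDigits xs * g + fromDigits ys * g ^ length xs * g
    ≡⟨ cong (x + fromDigits xs * g +_) (trans (*-assoc (fromDigits ys) _ g)
                                               (cong (fromDigits ys *_) (*-comm (g ^ length xs) g))) ⟩
      x + fromDigits xs * g + fromDigits ys * g ^ suc (length xs)
    ∎
    where open ≡-Reasoning

  suc-/-≤ : ∀ m → suc m / g ≤ m
  suc-/-≤ m = <⇒≤pred (m/n<m (suc m) g 2≤g)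

  fromDigits-digitsAux : ∀ f n → n ≤ f → fromDigits (digitsAux g f n) ≡ n
  fromDigits-digitsAux zero    zero    _         = refl
  fromDigits-digitsAux (suc f) zero    _         = refl
  fromDigits-digitsAux (suc f) (suc m) (s≤s m≤f) =
    trans (cong (λ q → suc m % g + q * g)
                (fromDigits-digitsAux f (suc m / g) (≤-trans (suc-/-≤ m) m≤f)))
          (sym (m≡m%n+[m/n]*n (suc m) g))

  fromDigits-digits : ∀ n → fromDigits (digits g n) ≡ n
  fromDigits-digits n = fromDigits-digitsAux n n ≤-refl

  digitsAux-fuel : ∀ f f′ n → n ≤ f → n ≤ f′ → digitsAux g f n ≡ digitsAux g f′ n
  digitsAux-fuel zero    zero     zero    _         _          = refl
  digitsAux-fuel zero    (suc f′) zero    _         _          = refl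
  digitsAux-fuel (suc f) zero     zero    _         _          = refl
  digitsAux-fuel (suc f) (suc f′) zero    _         _          = refl
  digitsAux-fuel (suc f) (suc f′) (suc m) (s≤s m≤f) (s≤s m≤f′) =
    cong (suc m % g ∷_) (digitsAux-fuel f f′ (suc m / g)
                          (≤-trans (suc-/-≤ m) m≤f) (≤-trans (suc-/-≤ m) m≤f′))

  digits-pos : ∀ n → 0 < n → digits g n ≡ n % g ∷ digitsAux g (pred n) (n / g)
  digits-pos (suc k) _ = refl

  digits-*g : ∀ m → 0 < m → digits g (m * g) ≡ 0 ∷ digits g m
  digits-*g m 0<m = trans (digits-pos (m * g) (≤-<-trans z≤n m<m*g))
    (cong₂ _∷_ (m*n%n≡0 m g)
      (trans (cong (digitsAux g (pred (m * g))) (m*n/n≡m m g))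
             (digitsAux-fuel (pred (m * g)) m m (<⇒≤pred m<m*g) ≤-refl)))
    where
      instance _ = >-nonZero 0<m
      m<m*g : m < m * g
      m<m*g = m<m*n m g 2≤g

  IsNiven-*g : ∀ {m} → IsNiven g m → IsNiven g (m * g)
  IsNiven-*g {m} (0<m , s∣m) =
    ≤-<-trans z≤n (m<m*n m g 2≤g) ,
    subst (_∣ m * g) (sym (cong sumList (digits-*g m 0<m))) (∣m⇒∣m*n g s∣m)
    where instance _ = >-nonZero 0<m

  SumOfNiven-*g : ∀ {t m} → SumOfNiven g t m → SumOfNiven g t (m * g)
  SumOfNiven-*g (xs , refl , niven , refl) =
    List.map (_* g) xs , length-map (_* g) xs ,
    map⁺ (All.map IsNiven-*g niven) , sum-map-*ʳ g xs

  SumOfNiven-*g^ : ∀ k {t m} → SumOfNiven g t m → SumOfNiven g t (m * g ^ k)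
  SumOfNiven-*g^ zero    {t} {m} p = subst (SumOfNiven g t) (sym (*-identityʳ m)) p
  SumOfNiven-*g^ (suc k) {t} {m} p =
    subst (SumOfNiven g t) (trans (*-assoc m (g ^ k) g) (cong (m *_) (*-comm (g ^ k) g)))
          (SumOfNiven-*g (SumOfNiven-*g^ k p))

  SumOfNiven-+ : ∀ {t s a b} → SumOfNiven g t a → SumOfNiven g s b → SumOfNiven g (t + s) (a + b)
  SumOfNiven-+ (xs , refl , nx , refl) (ys , refl , ny , refl) =
    xs ++ ys , length-++ xs , ++⁺ nx ny , sum-++ xs ys

  SumOfNiven-fromDigits-concat :
    ∀ {v} (ns ts : Vec ℕ v) → (∀ i → SumOfNiven g (lookup ts i) (lookup ns i)) →
    SumOfNiven g (sum ts) (fromDigits (concat (toList (map (digits g) ns))))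
  SumOfNiven-fromDigits-concat [] [] _ = [] , refl , [] , refl
  SumOfNiven-fromDigits-concat (n ∷ ns) (t ∷ ts) h =
    subst (SumOfNiven g (t + sum ts)) (sym value)
      (SumOfNiven-+ (h zero)
        (SumOfNiven-*g^ (length (digits g n))
          (SumOfNiven-fromDigits-concat ns ts (λ i → h (suc i)))))
    where
      rest : List ℕ
      rest = concat (toList (map (digits g) ns))

      value : fromDigits (digits g n ++ rest) ≡ n + fromDigits rest * g ^ length (digits g n)
      value = trans (fromDigits-++ (digits g n) rest)
                    (cong (_+ fromDigits rest * g ^ length (digits g n)) (fromDigits-digits n))

lemma2 : (g : ℕ) → .{{_ : NonZero g}} → 2 ≤ g →
    (v : ℕ) → (n : ℕ) → (ns ts : Vec ℕ v) →
    0 < n → (∀ i → 0 < lookup ns i) →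
    digits g n ≡ concat (toList (map (digits g) ns)) →
    (∀ i → SumOfNiven g (lookup ts i) (lookup ns i)) →
    SumOfNiven g (sum ts) n
lemma2 g 2≤g v n ns ts _ _ concatenation h =
  subst (SumOfNiven g (sum ts))
    (trans (cong (fromDigits g 2≤g) (sym concatenation)) (fromDigits-digits g 2≤g n))
    (SumOfNiven-fromDigits-concat g 2≤g ns ts h)
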